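{- The category $\mathbf{PriM}$ has finite limits, and the forgetful functor $U:\mathbf{PriM}\to\mathbf{Set}$ preserves them.
   Context: $\mathbf{PriM}$ is defined as follows. Objects: the empty object $\emptyset$, and pairs $(S,s)$ with $S$ a nonempty recursively enumerable set and $s:\mathbb N\to S$ a chosen surjective primitive recursive enumeration (not necessarily injective). Morphisms: there is a unique morphism from $\emptyset$ to any object, and no morphism from a nonempty object into $\emptyset$; a morphism $(S,s)\to(T,t)$ is a function $f:S\to T$ for which there exists a primitive recursive $\tilde f:\mathbb N\to\mathbb N$ with $f\circ s=t\circ\tilde f$; composition is composition of functions. $U$ sends $\emptyset$ to the empty set, $(S,s)$ to $S$, and a morphism to its underlying function. -}

module Defs where

open import Level using (0ℓ)
open import Data.Nat using (ℕ; zero; suc)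
open import Data.Fin using (Fin)
open import Data.Vec using (Vec; []; _∷_; lookup)
open import Data.Product using (Σ; ∃; _×_; _,_; proj₁)
open import Data.Unit using (⊤; tt)
open import Data.Empty using (⊥)
open import Relation.Binary.PropositionalEquality using (_≡_)

data PR : ℕ → Set where
  zer  : ∀ {n} → PR n
  succ : PR 1
  proj : ∀ {n} → Fin n → PR n
  comp : ∀ {m n} → PR m → Vec (PR n) m → PR n
  prec : ∀ {n} → PR n → PR (suc (suc n)) → PR (suc n)

mutual
  eval : ∀ {n} → PR n → Vec ℕ n → ℕ
  eval zer xs = 0
  eval succ (x ∷ []) = suc x
  eval (proj i) xs = lookup xs i
  eval (comp f gs) xs = eval f (evalVec gs xs)
  eval (prec f g) (zero ∷ xs) = eval f xs
  eval (prec f g) (suc k ∷ xs) = eval g (k ∷ eval (prec f g) (k ∷ xs) ∷ xs)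

  evalVec : ∀ {m n} → Vec (PR n) m → Vec ℕ n → Vec ℕ m
  evalVec [] xs = []
  evalVec (g ∷ gs) xs = eval g xs ∷ evalVec gs xs

PrimRec : (ℕ → ℕ) → Set
PrimRec f = Σ (PR 1) λ e → ∀ n → eval e (n ∷ []) ≡ f n

-- A nonempty object (S , s): S ⊆ ℕ (a subset, i.e. proposition-valued
-- predicate), s : ℕ → S a surjective primitive recursive enumeration.
-- (S is then automatically nonempty and recursively enumerable.)
record NEObj : Set₁ where
  field
    S       : ℕ → Set
    S-prop  : ∀ x (p q : S x) → p ≡ q
    s       : ℕ → ℕ
    s-pr    : PrimRec s
    s-in    : ∀ n → S (s n)
    s-onto  : ∀ x → S x → ∃ λ n → s n ≡ x

  Carrier : Set
  Carrier = Σ ℕ S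

  enum : ℕ → Carrier
  enum n = s n , s-in n

open NEObj

data Obj : Set₁ where
  ∅  : Obj
  ob : NEObj → Obj

U : Obj → Set
U ∅      = ⊥
U (ob A) = Carrier A

record NEHom (A B : NEObj) : Set where
  field
    fun   : Carrier A → Carrier B
    track : Σ (ℕ → ℕ) λ f̃ → PrimRec f̃ × (∀ n → fun (enum A n) ≡ enum B (f̃ n))

Hom : Obj → Obj → Set
Hom ∅      B      = ⊤
Hom (ob A) ∅      = ⊥
Hom (ob A) (ob B) = NEHom A B

-- the forgetful functor on morphisms (composition in PriM is composition
-- of underlying functions, so U is faithful and we use it below)
Umap : ∀ {A B} → Hom A B → U A → U B
Umap {∅}    {B}    f ()
Umap {ob A} {∅}    () x
Umap {ob A} {ob B} f x = NEHom.fun f x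

_≗_ : {X Y : Set} → (X → Y) → (X → Y) → Set
f ≗ g = ∀ x → f x ≡ g x

_≈_ : ∀ {A B} → Hom A B → Hom A B → Set
f ≈ g = Umap f ≗ Umap g

_∘f_ : {X Y Z : Set} → (Y → Z) → (X → Y) → X → Z
(g ∘f f) x = g (f x)

IsTerminal : Obj → Set₁
IsTerminal T = ∀ X → Σ (Hom X T) λ u → ∀ (v : Hom X T) → v ≈ u

IsProduct : (A B P : Obj) → Hom P A → Hom P B → Set₁
IsProduct A B P π₁ π₂ =
  ∀ X (f : Hom X A) (g : Hom X B) →
    Σ (Hom X P) λ u →
      ((Umap π₁ ∘f Umap u) ≗ Umap f × (Umap π₂ ∘f Umap u) ≗ Umap g)
      × (∀ (v : Hom X P) → (Umap π₁ ∘f Umap v) ≗ Umap f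
                         → (Umap π₂ ∘f Umap v) ≗ Umap g → v ≈ u)

IsEqualizer : {A B : Obj} (f g : Hom A B) (E : Obj) → Hom E A → Set₁
IsEqualizer {A} {B} f g E e =
  ((Umap f ∘f Umap e) ≗ (Umap g ∘f Umap e))
  × (∀ X (h : Hom X A) → (Umap f ∘f Umap h) ≗ (Umap g ∘f Umap h) →
       Σ (Hom X E) λ u → ((Umap e ∘f Umap u) ≗ Umap h)
         × (∀ (v : Hom X E) → (Umap e ∘f Umap v) ≗ Umap h → v ≈ u))

IsTerminalSet : Set → Set₁
IsTerminalSet T = ∀ (X : Set) → Σ (X → T) λ u → ∀ (v : X → T) → v ≗ u

IsProductSet : (A B P : Set) → (P → A) → (P → B) → Set₁
IsProductSet A B P π₁ π₂ =
  ∀ (X : Set) (f : X → A) (g : X → B) →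
    Σ (X → P) λ u → ((π₁ ∘f u) ≗ f × (π₂ ∘f u) ≗ g)
      × (∀ (v : X → P) → (π₁ ∘f v) ≗ f → (π₂ ∘f v) ≗ g → v ≗ u)

IsEqualizerSet : {A B : Set} (f g : A → B) (E : Set) → (E → A) → Set₁
IsEqualizerSet {A} f g E e =
  ((f ∘f e) ≗ (g ∘f e))
  × (∀ (X : Set) (h : X → A) → (f ∘f h) ≗ (g ∘f h) →
       Σ (X → E) λ u → ((e ∘f u) ≗ h)
         × (∀ (v : X → E) → (e ∘f v) ≗ h → v ≗ u))

-- "PriM has finite limits and U preserves them", via the standard
-- characterisation: terminal object, binary products and equalizers,
-- each sent by U to the corresponding limit in Set.

HasPreservedTerminal : Set₁
HasPreservedTerminal = Σ Obj λ T → IsTerminal T × IsTerminalSet (U T)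

HasPreservedProducts : Set₁
HasPreservedProducts =
  ∀ (A B : Obj) → Σ Obj λ P → Σ (Hom P A) λ π₁ → Σ (Hom P B) λ π₂ →
    IsProduct A B P π₁ π₂ × IsProductSet (U A) (U B) (U P) (Umap π₁) (Umap π₂)

HasPreservedEqualizers : Set₁
HasPreservedEqualizers =
  ∀ (A B : Obj) (f g : Hom A B) → Σ Obj λ E → Σ (Hom E A) λ e →
    IsEqualizer f g E e × IsEqualizerSet (Umap f) (Umap g) (U E) (Umap e)

-- All limits are computed as in Set. The terminal object is {0}. The
-- product of (S , s) and (T , t) consists of the Cantor codes pair a b with
-- a ∈ S and b ∈ T, enumerated by n ↦ pair (s (unpair₁ n)) (t (unpair₂ n)),
-- which is primitive recursive because the diagonal on which a code lies
-- can be computed by primitive recursion; products with ∅ are ∅. The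
-- equalizer of f and g is the subset of S on which they agree. By excluded
-- middle it is either empty, hence ∅, or contains some s m₀; in the latter
-- case n ↦ (s n if t (f̃ n) = t (g̃ n), else s m₀) is a primitive recursive
-- enumeration of it. Mediating maps are tracked by the pair of the trackers
-- of their components, respectively by the tracker of the restricted map.

{-# OPTIONS --safe #-}
module Submission where

open import Defs
open import Level using (0ℓ)
open import Axiom.ExcludedMiddle using (ExcludedMiddle)
open import Data.Nat.Base using (ℕ; zero; suc; _+_; _∸_; _≤_; pred; ∣_-_∣)
open import Data.Nat.Properties
open import Data.Fin using (#_)
open import Data.Vec.Base using (Vec; []; _∷_)
open import Data.Product using (Σ; ∃; _×_; _,_; proj₁; proj₂)
open import Data.Unit.Base using (tt)
open import Data.Empty using (⊥-elim)
open import Relation.Binary.PropositionalEquality hiding (_≗_)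
open import Relation.Nullary using (¬_; yes; no)

open NEObj
open NEHom

PrimRec₂ : (ℕ → ℕ → ℕ) → Set
PrimRec₂ h = Σ (PR 2) λ e → ∀ a b → eval e (a ∷ b ∷ []) ≡ h a b

const : ∀ {n} → ℕ → PR n
const zero    = zer
const (suc k) = comp succ (const k ∷ [])

eval-const : ∀ {n} k (xs : Vec ℕ n) → eval (const k) xs ≡ k
eval-const zero    xs = refl
eval-const (suc k) xs = cong suc (eval-const k xs)

PrimRec-id : PrimRec (λ n → n)
PrimRec-id = proj (# 0) , λ _ → refl

PrimRec-suc : PrimRec suc
PrimRec-suc = succ , λ _ → refl

PrimRec-const : ∀ k → PrimRec (λ _ → k)
PrimRec-const k = const k , λ n → eval-const k (n ∷ [])

PrimRec-∘ : ∀ {f g} → PrimRec f → PrimRec g → PrimRec (λ n → f (g n))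
PrimRec-∘ {f} {g} (ef , pf) (eg , pg) = comp ef (eg ∷ []) , λ n →
  trans (cong (λ z → eval ef (z ∷ [])) (pg n)) (pf (g n))

PrimRec-∘₂ : ∀ {h f g} → PrimRec₂ h → PrimRec f → PrimRec g →
             PrimRec (λ n → h (f n) (g n))
PrimRec-∘₂ {h} {f} {g} (eh , ph) (ef , pf) (eg , pg) = comp eh (ef ∷ eg ∷ []) , λ n →
  trans (cong₂ (λ a b → eval eh (a ∷ b ∷ [])) (pf n) (pg n)) (ph (f n) (g n))

PrimRec-rec : ∀ {h} → PrimRec₂ h → (f : ℕ → ℕ) → (∀ n → f (suc n) ≡ h n (f n)) →
              PrimRec f
PrimRec-rec {h} (eh , ph) f f-suc = prec (const (f 0)) eh , go
  where
  go : ∀ n → eval (prec (const (f 0)) eh) (n ∷ []) ≡ f n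
  go zero    = eval-const (f 0) []
  go (suc n) = begin
    eval eh (n ∷ eval (prec (const (f 0)) eh) (n ∷ []) ∷ []) ≡⟨ cong (λ z → eval eh (n ∷ z ∷ [])) (go n) ⟩
    eval eh (n ∷ f n ∷ [])                                  ≡⟨ ph n (f n) ⟩
    h n (f n)                                               ≡⟨ f-suc n ⟨
    f (suc n)                                               ∎
    where open ≡-Reasoning

PrimRec₂-fst : PrimRec₂ (λ a b → a)
PrimRec₂-fst = proj (# 0) , λ _ _ → refl

PrimRec₂-snd : PrimRec₂ (λ a b → b)
PrimRec₂-snd = proj (# 1) , λ _ _ → refl

PrimRec₂-∘ : ∀ {h f} → PrimRec h → PrimRec₂ f → PrimRec₂ (λ a b → h (f a b))
PrimRec₂-∘ {h} {f} (eh , ph) (ef , pf) = comp eh (ef ∷ []) , λ a b →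
  trans (cong (λ z → eval eh (z ∷ [])) (pf a b)) (ph (f a b))

PrimRec₂-∘₂ : ∀ {h f g} → PrimRec₂ h → PrimRec₂ f → PrimRec₂ g →
              PrimRec₂ (λ a b → h (f a b) (g a b))
PrimRec₂-∘₂ {h} {f} {g} (eh , ph) (ef , pf) (eg , pg) = comp eh (ef ∷ eg ∷ []) , λ a b →
  trans (cong₂ (λ x y → eval eh (x ∷ y ∷ [])) (pf a b) (pg a b)) (ph (f a b) (g a b))

PrimRec₂-resp : ∀ {h k} → (∀ a b → h a b ≡ k a b) → PrimRec₂ h → PrimRec₂ k
PrimRec₂-resp h≡k (e , p) = e , λ a b → trans (p a b) (h≡k a b)

PrimRec₂-+ : PrimRec₂ _+_
PrimRec₂-+ = add , eval-add
  where
  add : PR 2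
  add = prec (proj (# 0)) (comp succ (proj (# 1) ∷ []))
  eval-add : ∀ a b → eval add (a ∷ b ∷ []) ≡ a + b
  eval-add zero    b = refl
  eval-add (suc a) b = cong suc (eval-add a b)

PrimRec₂-∸ : PrimRec₂ _∸_
PrimRec₂-∸ = comp monus (proj (# 1) ∷ proj (# 0) ∷ []) , λ a b → eval-monus b a
  where
  predecessor : PR 1
  predecessor = prec zer (proj (# 0))
  eval-pred : ∀ r → eval predecessor (r ∷ []) ≡ pred r
  eval-pred zero    = refl
  eval-pred (suc r) = refl
  monus : PR 2
  monus = prec (proj (# 0)) (comp predecessor (proj (# 1) ∷ []))
  eval-monus : ∀ b a → eval monus (b ∷ a ∷ []) ≡ a ∸ b
  eval-monus zero    a = refl
  eval-monus (suc b) a = begin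
    eval predecessor (eval monus (b ∷ a ∷ []) ∷ []) ≡⟨ eval-pred (eval monus (b ∷ a ∷ [])) ⟩
    pred (eval monus (b ∷ a ∷ []))                 ≡⟨ cong pred (eval-monus b a) ⟩
    pred (a ∸ b)                                   ≡⟨ pred[m∸n]≡m∸[1+n] a b ⟩
    a ∸ suc b                                      ∎
    where open ≡-Reasoning

∣-∣≡∸+∸ : ∀ a b → ∣ a - b ∣ ≡ (a ∸ b) + (b ∸ a)
∣-∣≡∸+∸ zero    zero    = refl
∣-∣≡∸+∸ zero    (suc b) = refl
∣-∣≡∸+∸ (suc a) zero    = sym (+-identityʳ (suc a))
∣-∣≡∸+∸ (suc a) (suc b) = ∣-∣≡∸+∸ a b

PrimRec₂-∣-∣ : PrimRec₂ ∣_-_∣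
PrimRec₂-∣-∣ = PrimRec₂-resp (λ a b → sym (∣-∣≡∸+∸ a b))
  (PrimRec₂-∘₂ PrimRec₂-+ PrimRec₂-∸ (PrimRec₂-∘₂ PrimRec₂-∸ PrimRec₂-snd PrimRec₂-fst))

δ : ℕ → ℕ → ℕ
δ a b = 1 ∸ ∣ a - b ∣

δ-refl : ∀ a → δ a a ≡ 1
δ-refl a = cong (1 ∸_) (∣n-n∣≡0 a)

δ-≢ : ∀ {a b} → a ≢ b → δ a b ≡ 0
δ-≢ a≢b = m≤n⇒m∸n≡0 (n≢0⇒n>0 (λ d → a≢b (∣m-n∣≡0⇒m≡n d)))

PrimRec₂-δ : PrimRec₂ δ
PrimRec₂-δ = PrimRec₂-∘₂ PrimRec₂-∸ (const 1 , λ a b → eval-const 1 (a ∷ b ∷ [])) PrimRec₂-∣-∣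

triangle : ℕ → ℕ
triangle zero    = 0
triangle (suc m) = triangle m + suc m

PrimRec-triangle : PrimRec triangle
PrimRec-triangle = PrimRec-rec
  (PrimRec₂-∘₂ PrimRec₂-+ PrimRec₂-snd (PrimRec₂-∘ PrimRec-suc PrimRec₂-fst))
  triangle (λ _ → refl)

pair : ℕ → ℕ → ℕ
pair a b = triangle (a + b) + b

-- The codes triangle m + j (j ≤ m) form the m-th diagonal, so the diagonal
-- index goes up by one exactly after its last code triangle m + m.
diagonal : ℕ → ℕ
diagonal zero    = 0
diagonal (suc n) = diagonal n + δ (n ∸ triangle (diagonal n)) (diagonal n)

PrimRec-diagonal : PrimRec diagonal
PrimRec-diagonal = PrimRec-rec
  (PrimRec₂-∘₂ PrimRec₂-+ PrimRec₂-snd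
    (PrimRec₂-∘₂ PrimRec₂-δ
      (PrimRec₂-∘₂ PrimRec₂-∸ PrimRec₂-fst (PrimRec₂-∘ PrimRec-triangle PrimRec₂-snd))
      PrimRec₂-snd))
  diagonal (λ _ → refl)

diagonal-suc : ∀ m j → diagonal (triangle m + j) ≡ m →
               diagonal (suc (triangle m + j)) ≡ m + δ j m
diagonal-suc m j d≡m rewrite d≡m | m+n∸m≡n (triangle m) j = refl

diagonal-triangle : ∀ m j → j ≤ m → diagonal (triangle m + j) ≡ m
diagonal-triangle zero    zero    _   = refl
diagonal-triangle (suc m) zero    _   = begin
  diagonal (triangle m + suc m + 0)  ≡⟨ cong diagonal (trans (+-identityʳ _) (+-suc (triangle m) m)) ⟩
  diagonal (suc (triangle m + m))    ≡⟨ diagonal-suc m m (diagonal-triangle m m ≤-refl) ⟩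
  m + δ m m                          ≡⟨ cong (m +_) (δ-refl m) ⟩
  m + 1                              ≡⟨ +-comm m 1 ⟩
  suc m                              ∎
  where open ≡-Reasoning
diagonal-triangle m       (suc j) j<m = begin
  diagonal (triangle m + suc j)      ≡⟨ cong diagonal (+-suc (triangle m) j) ⟩
  diagonal (suc (triangle m + j))    ≡⟨ diagonal-suc m j (diagonal-triangle m j (<⇒≤ j<m)) ⟩
  m + δ j m                          ≡⟨ cong (m +_) (δ-≢ (<⇒≢ j<m)) ⟩
  m + 0                              ≡⟨ +-identityʳ m ⟩
  m                                  ∎
  where open ≡-Reasoning

unpair₂ : ℕ → ℕ
unpair₂ n = n ∸ triangle (diagonal n)

unpair₁ : ℕ → ℕ
unpair₁ n = diagonal n ∸ unpair₂ n

PrimRec-unpair₂ : PrimRec unpair₂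
PrimRec-unpair₂ = PrimRec-∘₂ PrimRec₂-∸ PrimRec-id (PrimRec-∘ PrimRec-triangle PrimRec-diagonal)

PrimRec-unpair₁ : PrimRec unpair₁
PrimRec-unpair₁ = PrimRec-∘₂ PrimRec₂-∸ PrimRec-diagonal PrimRec-unpair₂

PrimRec₂-pair : PrimRec₂ pair
PrimRec₂-pair = PrimRec₂-∘₂ PrimRec₂-+ (PrimRec₂-∘ PrimRec-triangle PrimRec₂-+) PrimRec₂-snd

diagonal-pair : ∀ a b → diagonal (pair a b) ≡ a + b
diagonal-pair a b = diagonal-triangle (a + b) b (m≤n+m b a)

unpair₂-pair : ∀ a b → unpair₂ (pair a b) ≡ b
unpair₂-pair a b rewrite diagonal-pair a b = m+n∸m≡n (triangle (a + b)) b

unpair₁-pair : ∀ a b → unpair₁ (pair a b) ≡ a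
unpair₁-pair a b rewrite unpair₂-pair a b | diagonal-pair a b = m+n∸n≡m a b

private
  variable
    A B C : NEObj

proj₁-injective : (A : NEObj) {x y : Carrier A} → proj₁ x ≡ proj₁ y → x ≡ y
proj₁-injective A {x , p} {.x , q} refl = cong (x ,_) (S-prop A x p q)

tracker : NEHom A B → ℕ → ℕ
tracker f = proj₁ (track f)

tracker-pr : (f : NEHom A B) → PrimRec (tracker f)
tracker-pr f = proj₁ (proj₂ (track f))

tracks : (f : NEHom A B) → ∀ n → fun f (enum A n) ≡ enum B (tracker f n)
tracks f = proj₂ (proj₂ (track f))

𝟙 : NEObj
𝟙 = record
  { S      = λ x → x ≡ 0
  ; S-prop = λ _ → ≡-irrelevant
  ; s      = λ _ → 0
  ; s-pr   = PrimRec-const 0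
  ; s-in   = λ _ → refl
  ; s-onto = λ _ x≡0 → 0 , sym x≡0
  }

terminal : HasPreservedTerminal
terminal = ob 𝟙 , isTerminal , isTerminalSet
  where
  ! : {X : Set} → X → Carrier 𝟙
  ! _ = 0 , refl
  !-unique : {X : Set} (v : X → Carrier 𝟙) → v ≗ !
  !-unique v x = proj₁-injective 𝟙 (proj₂ (v x))
  isTerminal : IsTerminal (ob 𝟙)
  isTerminal ∅      = tt , λ _ ()
  isTerminal (ob A) = record { fun = ! ; track = (λ _ → 0) , PrimRec-const 0 , λ _ → refl }
                    , λ v → !-unique (fun v)
  isTerminalSet : IsTerminalSet (Carrier 𝟙)
  isTerminalSet X = ! , !-unique

∅-isProduct : (A B : Obj) → ¬ (U A × U B) →
  IsProduct A B ∅ tt tt × IsProductSet (U A) (U B) (U ∅) (Umap {∅} {A} tt) (Umap {∅} {B} tt)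
∅-isProduct A B noPair = isProduct , isProductSet
  where
  isProduct : IsProduct A B ∅ tt tt
  isProduct ∅      f g = tt , ((λ ()) , (λ ())) , λ _ _ _ ()
  isProduct (ob C) f g = ⊥-elim (noPair (Umap f (enum C 0) , Umap g (enum C 0)))
  isProductSet : IsProductSet (U A) (U B) (U ∅) (Umap {∅} {A} tt) (Umap {∅} {B} tt)
  isProductSet X f g = absurd , ((λ x → absurd x) , (λ x → absurd x)) , λ _ _ _ x → absurd x
    where
    absurd : {Y : Set} → X → Y
    absurd x = ⊥-elim (noPair (f x , g x))

module Product (A B : NEObj) where

  -- pair is onto, but demanding the last conjunct spares us proving it.
  IsPairCode : ℕ → Set
  IsPairCode x = S A (unpair₁ x) × S B (unpair₂ x) × pair (unpair₁ x) (unpair₂ x) ≡ x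

  IsPairCode-prop : ∀ x (p q : IsPairCode x) → p ≡ q
  IsPairCode-prop x (a , b , e) (a′ , b′ , e′)
    rewrite S-prop A (unpair₁ x) a a′ | S-prop B (unpair₂ x) b b′ | ≡-irrelevant e e′ = refl

  pair-isPairCode : ∀ {a b} → S A a → S B b → IsPairCode (pair a b)
  pair-isPairCode {a} {b} a∈A b∈B rewrite unpair₁-pair a b | unpair₂-pair a b = a∈A , b∈B , refl

  enumPair : ℕ → ℕ
  enumPair n = pair (s A (unpair₁ n)) (s B (unpair₂ n))

  enumPair-onto : ∀ x → IsPairCode x → ∃ λ n → enumPair n ≡ x
  enumPair-onto x (a∈A , b∈B , x-pair) with s-onto A (unpair₁ x) a∈A | s-onto B (unpair₂ x) b∈B
  ... | i , sᵢ | j , sⱼ = pair i j , (begin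
    enumPair (pair i j)           ≡⟨ cong₂ (λ u v → pair (s A u) (s B v)) (unpair₁-pair i j) (unpair₂-pair i j) ⟩
    pair (s A i) (s B j)          ≡⟨ cong₂ pair sᵢ sⱼ ⟩
    pair (unpair₁ x) (unpair₂ x)  ≡⟨ x-pair ⟩
    x                             ∎)
    where open ≡-Reasoning

  A×B : NEObj
  A×B = record
    { S      = IsPairCode
    ; S-prop = IsPairCode-prop
    ; s      = enumPair
    ; s-pr   = PrimRec-∘₂ PrimRec₂-pair (PrimRec-∘ (s-pr A) PrimRec-unpair₁)
                                        (PrimRec-∘ (s-pr B) PrimRec-unpair₂)
    ; s-in   = λ n → pair-isPairCode (s-in A (unpair₁ n)) (s-in B (unpair₂ n))
    ; s-onto = enumPair-onto
    }

  ⟨_,_⟩ₑ : Carrier A → Carrier B → Carrier A×B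
  ⟨ (a , a∈A) , (b , b∈B) ⟩ₑ = pair a b , pair-isPairCode a∈A b∈B

  ⟨,⟩ₑ-enum : ∀ i j → ⟨ enum A i , enum B j ⟩ₑ ≡ enum A×B (pair i j)
  ⟨,⟩ₑ-enum i j = proj₁-injective A×B
    (sym (cong₂ (λ u v → pair (s A u) (s B v)) (unpair₁-pair i j) (unpair₂-pair i j)))

  π₁ : NEHom A×B A
  π₁ = record
    { fun   = λ (x , a∈A , _) → unpair₁ x , a∈A
    ; track = unpair₁ , PrimRec-unpair₁ , λ n → proj₁-injective A (unpair₁-pair _ _)
    }

  π₂ : NEHom A×B B
  π₂ = record
    { fun   = λ (x , _ , b∈B , _) → unpair₂ x , b∈B
    ; track = unpair₂ , PrimRec-unpair₂ , λ n → proj₁-injective B (unpair₂-pair (s A (unpair₁ n)) _)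
    }

  π₁-⟨,⟩ₑ : ∀ a b → fun π₁ ⟨ a , b ⟩ₑ ≡ a
  π₁-⟨,⟩ₑ (a , _) (b , _) = proj₁-injective A (unpair₁-pair a b)

  π₂-⟨,⟩ₑ : ∀ a b → fun π₂ ⟨ a , b ⟩ₑ ≡ b
  π₂-⟨,⟩ₑ (a , _) (b , _) = proj₁-injective B (unpair₂-pair a b)

  ⟨,⟩ₑ-η : ∀ z → ⟨ fun π₁ z , fun π₂ z ⟩ₑ ≡ z
  ⟨,⟩ₑ-η (x , _ , _ , x-pair) = proj₁-injective A×B x-pair

  isProductSet : IsProductSet (Carrier A) (Carrier B) (Carrier A×B) (fun π₁) (fun π₂)
  isProductSet X f g = (λ x → ⟨ f x , g x ⟩ₑ)
                     , ((λ x → π₁-⟨,⟩ₑ (f x) (g x)) , (λ x → π₂-⟨,⟩ₑ (f x) (g x)))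
                     , λ v π₁v≗f π₂v≗g x →
                         trans (sym (⟨,⟩ₑ-η (v x))) (cong₂ ⟨_,_⟩ₑ (π₁v≗f x) (π₂v≗g x))

  ⟨_,_⟩ : NEHom C A → NEHom C B → NEHom C A×B
  ⟨_,_⟩ {C} f g = record
    { fun   = λ x → ⟨ fun f x , fun g x ⟩ₑ
    ; track = (λ n → pair (tracker f n) (tracker g n))
            , PrimRec-∘₂ PrimRec₂-pair (tracker-pr f) (tracker-pr g)
            , λ n → trans (cong₂ ⟨_,_⟩ₑ (tracks f n) (tracks g n))
                          (⟨,⟩ₑ-enum (tracker f n) (tracker g n))
    }

  isProduct : IsProduct (ob A) (ob B) (ob A×B) π₁ π₂
  isProduct ∅      f g = tt , ((λ ()) , (λ ())) , λ _ _ _ ()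
  isProduct (ob C) f g =
    let commutes , unique = proj₂ (isProductSet (Carrier C) (fun f) (fun g))
    in ⟨ f , g ⟩ , commutes , λ v → unique (fun v)

products : HasPreservedProducts
products ∅      B      = ∅ , tt , tt , ∅-isProduct ∅ B proj₁
products (ob A) ∅      = ∅ , tt , tt , ∅-isProduct (ob A) ∅ proj₂
products (ob A) (ob B) = ob A×B , π₁ , π₂ , isProduct , isProductSet
  where open Product A B

ifZero_then_else_ : ℕ → ℕ → ℕ → ℕ
ifZero zero  then x else y = x
ifZero suc _ then x else y = y

ifZero-0 : ∀ {c} x y → c ≡ 0 → ifZero c then x else y ≡ x
ifZero-0 x y refl = refl

ifZero-elim : (P : ℕ → Set) → ∀ {c x y} → (c ≡ 0 → P x) → P y → P (ifZero c then x else y)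
ifZero-elim P {zero}  Px Py = Px refl
ifZero-elim P {suc _} Px Py = Py

PrimRec₂-ifZero : ∀ k → PrimRec₂ (λ c x → ifZero c then x else k)
PrimRec₂-ifZero k = prec (proj (# 0)) (const k) , λ where
  zero    x → refl
  (suc c) x → eval-const k _

∅-isEqualizer : {A B : Obj} (f g : Hom A B) → ¬ Σ (U A) (λ a → Umap f a ≡ Umap g a) →
  IsEqualizer f g ∅ tt × IsEqualizerSet (Umap f) (Umap g) (U ∅) (Umap {∅} {A} tt)
∅-isEqualizer {A} f g noSolution = ((λ ()) , isUniversal) , ((λ ()) , isUniversalSet)
  where
  isUniversal : ∀ X (h : Hom X A) → (Umap f ∘f Umap h) ≗ (Umap g ∘f Umap h) →
                Σ (Hom X ∅) λ u → ((Umap {∅} {A} tt ∘f Umap u) ≗ Umap h)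
                  × (∀ (v : Hom X ∅) → (Umap {∅} {A} tt ∘f Umap v) ≗ Umap h → v ≈ u)
  isUniversal ∅      h fh≗gh = tt , (λ ()) , λ _ _ ()
  isUniversal (ob C) h fh≗gh = ⊥-elim (noSolution (Umap h (enum C 0) , fh≗gh (enum C 0)))
  isUniversalSet : ∀ (X : Set) (h : X → U A) → (Umap f ∘f h) ≗ (Umap g ∘f h) →
                   Σ (X → U ∅) λ u → ((Umap {∅} {A} tt ∘f u) ≗ h)
                     × (∀ (v : X → U ∅) → (Umap {∅} {A} tt ∘f v) ≗ h → v ≗ u)
  isUniversalSet X h fh≗gh = absurd , (λ x → absurd x) , λ _ _ x → absurd x
    where
    absurd : {Y : Set} → X → Y
    absurd x = ⊥-elim (noSolution (h x , fh≗gh x))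

module Equalizer {A B : NEObj} (f g : NEHom A B) (solution : Σ (Carrier A) λ a → fun f a ≡ fun g a) where

  Solves : Carrier A → Set
  Solves a = proj₁ (fun f a) ≡ proj₁ (fun g a)

  m₀ : ℕ
  m₀ = proj₁ (s-onto A (proj₁ (proj₁ solution)) (proj₂ (proj₁ solution)))

  enum-m₀ : enum A m₀ ≡ proj₁ solution
  enum-m₀ = proj₁-injective A (proj₂ (s-onto A (proj₁ (proj₁ solution)) (proj₂ (proj₁ solution))))

  m₀-solves : Solves (enum A m₀)
  m₀-solves = subst Solves (sym enum-m₀) (cong proj₁ (proj₂ solution))

  solves⇒trackers : ∀ {n} → Solves (enum A n) → s B (tracker f n) ≡ s B (tracker g n)
  solves⇒trackers {n} fn≡gn =
    trans (sym (cong proj₁ (tracks f n))) (trans fn≡gn (cong proj₁ (tracks g n)))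

  trackers⇒solves : ∀ {n} → s B (tracker f n) ≡ s B (tracker g n) → Solves (enum A n)
  trackers⇒solves {n} f̃n≡g̃n =
    trans (cong proj₁ (tracks f n)) (trans f̃n≡g̃n (sym (cong proj₁ (tracks g n))))

  select : ℕ → ℕ
  select n = ifZero ∣ s B (tracker f n) - s B (tracker g n) ∣ then n else m₀

  PrimRec-select : PrimRec select
  PrimRec-select = PrimRec-∘₂ (PrimRec₂-ifZero m₀)
    (PrimRec-∘₂ PrimRec₂-∣-∣ (PrimRec-∘ (s-pr B) (tracker-pr f)) (PrimRec-∘ (s-pr B) (tracker-pr g)))
    PrimRec-id

  select-fixes : ∀ {n} → Solves (enum A n) → select n ≡ n
  select-fixes {n} fn≡gn = ifZero-0 n m₀ (m≡n⇒∣m-n∣≡0 (solves⇒trackers fn≡gn))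

  select-solves : ∀ n → Solves (enum A (select n))
  select-solves n = ifZero-elim (λ m → Solves (enum A m))
    (λ d≡0 → trackers⇒solves (∣m-n∣≡0⇒m≡n d≡0)) m₀-solves

  IsSolutionCode : ℕ → Set
  IsSolutionCode x = Σ (S A x) λ x∈A → Solves (x , x∈A)

  IsSolutionCode-prop : ∀ x (p q : IsSolutionCode x) → p ≡ q
  IsSolutionCode-prop x (a , e) (a′ , e′) with S-prop A x a a′
  ... | refl = cong (a ,_) (≡-irrelevant e e′)

  enumSolution-onto : ∀ x → IsSolutionCode x → ∃ λ n → s A (select n) ≡ x
  enumSolution-onto x (x∈A , fx≡gx) with s-onto A x x∈A
  ... | i , sᵢ = i , trans (cong (s A) (select-fixes fi≡gi)) sᵢ
    where
    fi≡gi : Solves (enum A i)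
    fi≡gi = subst Solves (sym (proj₁-injective A sᵢ)) fx≡gx

  E : NEObj
  E = record
    { S      = IsSolutionCode
    ; S-prop = IsSolutionCode-prop
    ; s      = λ n → s A (select n)
    ; s-pr   = PrimRec-∘ (s-pr A) PrimRec-select
    ; s-in   = λ n → s-in A (select n) , select-solves n
    ; s-onto = enumSolution-onto
    }

  ι : NEHom E A
  ι = record { fun = λ (x , x∈A , _) → x , x∈A ; track = select , PrimRec-select , λ _ → refl }

  ι-equalizes : (fun f ∘f fun ι) ≗ (fun g ∘f fun ι)
  ι-equalizes (_ , _ , fx≡gx) = proj₁-injective B fx≡gx

  restrict : {X : Set} (h : X → Carrier A) → (fun f ∘f h) ≗ (fun g ∘f h) → X → Carrier E
  restrict h fh≗gh x = proj₁ (h x) , proj₂ (h x) , cong proj₁ (fh≗gh x)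

  restrict-unique : {X : Set} (h : X → Carrier A) (fh≗gh : (fun f ∘f h) ≗ (fun g ∘f h)) →
                    ∀ (v : X → Carrier E) → (fun ι ∘f v) ≗ h → v ≗ restrict h fh≗gh
  restrict-unique h fh≗gh v ιv≗h x = proj₁-injective E (cong proj₁ (ιv≗h x))

  isEqualizerSet : IsEqualizerSet (fun f) (fun g) (Carrier E) (fun ι)
  isEqualizerSet = ι-equalizes , λ X h fh≗gh →
    restrict h fh≗gh , (λ _ → refl) , restrict-unique h fh≗gh

  restrictHom : (h : NEHom C A) → (fun f ∘f fun h) ≗ (fun g ∘f fun h) → NEHom C E
  restrictHom {C} h fh≗gh = record
    { fun   = restrict (fun h) fh≗gh
    ; track = tracker h , tracker-pr h , λ n → proj₁-injective E (begin
        proj₁ (fun h (enum C n))     ≡⟨ cong proj₁ (tracks h n) ⟩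
        s A (tracker h n)            ≡⟨ cong (s A) (select-fixes (h̃-solves n)) ⟨
        s A (select (tracker h n))   ∎)
    }
    where
    open ≡-Reasoning
    h̃-solves : ∀ n → Solves (enum A (tracker h n))
    h̃-solves n = subst Solves (tracks h n) (cong proj₁ (fh≗gh (enum C n)))

  isEqualizer : IsEqualizer {ob A} {ob B} f g (ob E) ι
  isEqualizer = ι-equalizes , isUniversal
    where
    isUniversal : ∀ X (h : Hom X (ob A)) → (Umap f ∘f Umap h) ≗ (Umap g ∘f Umap h) →
                  Σ (Hom X (ob E)) λ u → ((Umap ι ∘f Umap u) ≗ Umap h)
                    × (∀ (v : Hom X (ob E)) → (Umap ι ∘f Umap v) ≗ Umap h → v ≈ u)
    isUniversal ∅      h fh≗gh = tt , (λ ()) , λ _ _ ()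
    isUniversal (ob C) h fh≗gh = restrictHom h fh≗gh , (λ _ → refl)
                               , λ v → restrict-unique (fun h) fh≗gh (fun v)

equalizers : ExcludedMiddle 0ℓ → HasPreservedEqualizers
equalizers em A B f g with em {Σ (U A) λ a → Umap f a ≡ Umap g a}
... | no noSolution = ∅ , tt , ∅-isEqualizer f g noSolution
equalizers em ∅      B      f  g | yes (() , _)
equalizers em (ob A) ∅      () g | yes _
equalizers em (ob A) (ob B) f  g | yes solution = ob E , ι , isEqualizer , isEqualizerSet
  where open Equalizer f g solution

lemma5p2 : ExcludedMiddle 0ℓ →
    HasPreservedTerminal × HasPreservedProducts × HasPreservedEqualizers
lemma5p2 em = terminal , products , equalizers em
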